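{- For any integers $n\ge 2$ and $1\le k\le F_{n-1}$, $$ \mathrm{odfib}(F_n + k) = 2^n + \mathrm{odfib}(k). $$
   Context: The Fibonacci numbers are defined by $F_0=0$, $F_1=1$, $F_n=F_{n-1}+F_{n-2}$ for $n\ge 2$. The fibbinary numbers are the positive integers whose binary representation contains no two consecutive ones. $\mathrm{odfib}(n)$ denotes the $n$th odd fibbinary number in increasing order (so $\mathrm{odfib}(1)=1$, $\mathrm{odfib}(2)=101_2=5$, $\mathrm{odfib}(3)=1001_2=9,\dots$). -}

module Defs where

open import Data.Nat using (ℕ; zero; suc; _+_; _*_; _∸_; _^_; _≤_; _<_)
open import Data.Nat.DivMod using (_/_; _%_)
open import Data.Bool using (Bool; true; false; _∧_; not)

F : ℕ → ℕ
F 0 = 0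
F 1 = 1
F (suc (suc n)) = F (suc n) + F n

-- binary representation of m has no two consecutive ones
-- (checks bit pairs (b_i, b_{i+1}) for all i; fuel = m suffices since m halves)
noAdjOnes : ℕ → ℕ → Bool
noAdjOnes zero    m = true
noAdjOnes (suc f) zero = true
noAdjOnes (suc f) m@(suc _) =
  not ((m % 2 Data.Nat.≡ᵇ 1) ∧ ((m / 2) % 2 Data.Nat.≡ᵇ 1)) ∧ noAdjOnes f (m / 2)

isOddFibbinary : ℕ → Bool
isOddFibbinary m = (m % 2 Data.Nat.≡ᵇ 1) ∧ noAdjOnes m m

-- least m' with  m < m' ≤ m + fuel  and isOddFibbinary m' (returns m + fuel + 1 if none)
nextFrom : ℕ → ℕ → ℕ
nextFrom zero    m = suc m
nextFrom (suc f) m with isOddFibbinary (suc m)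
... | true  = suc m
... | false = nextFrom f (suc m)

-- least odd fibbinary number strictly greater than m; for m odd fibbinary
-- (or m = 0) the number 4m+1 is odd fibbinary, so searching 3m+1 steps suffices
nextOdfib : ℕ → ℕ
nextOdfib m = nextFrom (3 * m + 1) m

-- odfib n = n-th odd fibbinary number in increasing order (1-indexed);
-- odfib 0 = 0 is a junk value (never used for n ≥ 1 in the statement)
odfib : ℕ → ℕ
odfib zero    = 0
odfib (suc n) = nextOdfib (odfib n)

-- In binary, an odd fibbinary number in [2^n, 2^(n+1)) must start with 10, so it is 2^n + y
-- for an odd fibbinary y < 2^(n-1), and every such 2^n + y is odd fibbinary; numbers starting
-- with 11 are not.  Hence the odd fibbinary numbers below 2^(n+1) are those below 2^n followed,
-- in the same order, by 2^n plus those below 2^(n-1).  By induction there are F n of them below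
-- 2^n, and the (F n + k)-th one is 2^n + odfib k.
module Submission where

open import Defs
open import Data.Nat using (ℕ; _+_; _^_; _≤_; _∸_)
open import Relation.Binary.PropositionalEquality using (_≡_)

open import Data.Bool using (Bool; true; false; _∧_; not)
open import Data.Bool.Properties using (∧-zeroʳ)
open import Data.Empty using (⊥-elim)
open import Data.Nat using (zero; suc; _*_; _<_; _≤′_; ≤′-refl; ≤′-step; _%_; _/_; _≡ᵇ_; z≤n; s≤s)
open import Data.Nat.DivMod using (m*n%n≡0; [m+kn]%n≡m%n; m*n/n≡m; +-distrib-/; m/n<m; /-monoˡ-≤; m<n*o⇒m/o<n)
open import Data.Nat.Properties
open import Data.Nat.Tactic.RingSolver using (solve-∀)
open import Data.Product using (_×_; _,_; proj₁; proj₂)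
open import Data.Sum using (inj₁; inj₂)
open import Relation.Binary.PropositionalEquality using (refl; sym; trans; cong; cong₂; subst; module ≡-Reasoning)
open import Relation.Nullary using (yes; no)

open ≡-Reasoning

isOdd : ℕ → Bool
isOdd m = m % 2 ≡ᵇ 1

fibbinary : ℕ → Bool
fibbinary m = noAdjOnes m m

noAdjOnes-zero : ∀ f → noAdjOnes f 0 ≡ true
noAdjOnes-zero zero    = refl
noAdjOnes-zero (suc f) = refl

1+m≤1+f⇒[1+m]/2≤f : ∀ {m f} → suc m ≤ suc f → suc m / 2 ≤ f
1+m≤1+f⇒[1+m]/2≤f {m} 1+m≤1+f = ≤-pred (≤-trans (m/n<m (suc m) 2 (s≤s (s≤s z≤n))) 1+m≤1+f)

noAdjOnes-fuel : ∀ {f g} m → m ≤ f → m ≤ g → noAdjOnes f m ≡ noAdjOnes g m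
noAdjOnes-fuel {f}     {g}     zero    _   _   = trans (noAdjOnes-zero f) (sym (noAdjOnes-zero g))
noAdjOnes-fuel {suc f} {suc g} (suc m) m≤f m≤g =
  cong (not (isOdd (suc m) ∧ isOdd (suc m / 2)) ∧_)
    (noAdjOnes-fuel (suc m / 2) (1+m≤1+f⇒[1+m]/2≤f m≤f) (1+m≤1+f⇒[1+m]/2≤f m≤g))

fibbinary-unfold : ∀ m → fibbinary m ≡ not (isOdd m ∧ isOdd (m / 2)) ∧ fibbinary (m / 2)
fibbinary-unfold zero    = refl
fibbinary-unfold (suc m) =
  cong (not (isOdd (suc m) ∧ isOdd (suc m / 2)) ∧_)
    (noAdjOnes-fuel {m} (suc m / 2) (1+m≤1+f⇒[1+m]/2≤f ≤-refl) ≤-refl)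

[2*q]%2≡0 : ∀ q → (2 * q) % 2 ≡ 0
[2*q]%2≡0 q = trans (cong (_% 2) (*-comm 2 q)) (m*n%n≡0 q 2)

[1+2*q]%2≡1 : ∀ q → (1 + 2 * q) % 2 ≡ 1
[1+2*q]%2≡1 q = trans (cong (λ x → (1 + x) % 2) (*-comm 2 q)) ([m+kn]%n≡m%n 1 q 2)

[2*q]/2≡q : ∀ q → (2 * q) / 2 ≡ q
[2*q]/2≡q q = trans (cong (_/ 2) (*-comm 2 q)) (m*n/n≡m q 2)

[1+2*q]/2≡q : ∀ q → (1 + 2 * q) / 2 ≡ q
[1+2*q]/2≡q q =
  trans (+-distrib-/ 1 (2 * q) (subst (λ r → 1 + r < 2) (sym ([2*q]%2≡0 q)) ≤-refl)) ([2*q]/2≡q q)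

isOdd-2*+ : ∀ a q → isOdd (2 * a + q) ≡ isOdd q
isOdd-2*+ a q = cong (_≡ᵇ 1)
  (trans (cong (_% 2) (trans (+-comm (2 * a) q) (cong (q +_) (*-comm 2 a)))) ([m+kn]%n≡m%n q a 2))

fibbinary-2* : ∀ q → fibbinary (2 * q) ≡ fibbinary q
fibbinary-2* q rewrite fibbinary-unfold (2 * q) | [2*q]%2≡0 q | [2*q]/2≡q q = refl

fibbinary-1+2* : ∀ q → fibbinary (1 + 2 * q) ≡ not (isOdd q) ∧ fibbinary q
fibbinary-1+2* q rewrite fibbinary-unfold (1 + 2 * q) | [1+2*q]%2≡1 q | [1+2*q]/2≡q q = refl

isOddFibbinary-2* : ∀ q → isOddFibbinary (2 * q) ≡ false
isOddFibbinary-2* q rewrite [2*q]%2≡0 q = refl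

isOddFibbinary-1+4* : ∀ m → isOddFibbinary m ≡ true → isOddFibbinary (1 + 2 * (2 * m)) ≡ true
isOddFibbinary-1+4* m odd-fib = begin
  isOdd (1 + 2 * (2 * m)) ∧ fibbinary (1 + 2 * (2 * m))
    ≡⟨ cong₂ _∧_ (cong (_≡ᵇ 1) ([1+2*q]%2≡1 (2 * m))) (fibbinary-1+2* (2 * m)) ⟩
  not (isOdd (2 * m)) ∧ fibbinary (2 * m)
    ≡⟨ cong₂ (λ b c → not b ∧ c) (cong (_≡ᵇ 1) ([2*q]%2≡0 m)) (fibbinary-2* m) ⟩
  fibbinary m
    ≡⟨ fibbinary-of-odd (isOdd m) odd-fib ⟩
  true ∎
  where
    fibbinary-of-odd : ∀ b → b ∧ fibbinary m ≡ true → fibbinary m ≡ true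
    fibbinary-of-odd true fib = fib

data EvenOdd : ℕ → Set where
  even : ∀ q → EvenOdd (2 * q)
  odd  : ∀ q → EvenOdd (1 + 2 * q)

evenOdd : ∀ m → EvenOdd m
evenOdd zero          = even 0
evenOdd (suc zero)    = odd 0
evenOdd (suc (suc m)) with evenOdd m
... | even q = subst EvenOdd (*-suc 2 q) (even (suc q))
... | odd q  = subst EvenOdd (cong suc (*-suc 2 q)) (odd (suc q))

fibbinary-2^+ : ∀ n y → y < 2 ^ n → fibbinary (2 ^ suc n + y) ≡ fibbinary y
fibbinary-2^+ zero    zero    _        = refl
fibbinary-2^+ zero    (suc _) (s≤s ())
fibbinary-2^+ (suc n) y       y<2^1+n with evenOdd y
... | even q = begin
  fibbinary (P + 2 * q)          ≡⟨ cong fibbinary (sym (*-distribˡ-+ 2 (2 ^ suc n) q)) ⟩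
  fibbinary (2 * (2 ^ suc n + q)) ≡⟨ fibbinary-2* (2 ^ suc n + q) ⟩
  fibbinary (2 ^ suc n + q)       ≡⟨ fibbinary-2^+ n q (*-cancelˡ-< 2 q (2 ^ n) y<2^1+n) ⟩
  fibbinary q                     ≡⟨ sym (fibbinary-2* q) ⟩
  fibbinary (2 * q)               ∎
  where P = 2 ^ suc (suc n)
... | odd q = begin
  fibbinary (P + (1 + 2 * q))
    ≡⟨ cong fibbinary (trans (+-suc P (2 * q)) (cong suc (sym (*-distribˡ-+ 2 (2 ^ suc n) q)))) ⟩
  fibbinary (1 + 2 * (2 ^ suc n + q))
    ≡⟨ fibbinary-1+2* (2 ^ suc n + q) ⟩
  not (isOdd (2 ^ suc n + q)) ∧ fibbinary (2 ^ suc n + q)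
    ≡⟨ cong₂ (λ b c → not b ∧ c) (isOdd-2*+ (2 ^ n) q) (fibbinary-2^+ n q q<2^n) ⟩
  not (isOdd q) ∧ fibbinary q
    ≡⟨ sym (fibbinary-1+2* q) ⟩
  fibbinary (1 + 2 * q) ∎
  where
    P = 2 ^ suc (suc n)
    q<2^n : q < 2 ^ n
    q<2^n = *-cancelˡ-< 2 q (2 ^ n) (<-trans (n<1+n (2 * q)) y<2^1+n)

isOddFibbinary-2^+ : ∀ n y → y < 2 ^ n → isOddFibbinary (2 ^ suc n + y) ≡ isOddFibbinary y
isOddFibbinary-2^+ n y y<2^n = cong₂ _∧_ (isOdd-2*+ (2 ^ n) y) (fibbinary-2^+ n y y<2^n)

fibbinary-leading-11 : ∀ n x → 2 ^ suc n + 2 ^ n ≤ x → x < 2 ^ suc (suc n) → fibbinary x ≡ false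
fibbinary-leading-11 zero .3 (s≤s (s≤s (s≤s z≤n))) (s≤s (s≤s (s≤s (s≤s z≤n)))) = refl
fibbinary-leading-11 (suc n) x lo hi = begin
  fibbinary x
    ≡⟨ fibbinary-unfold x ⟩
  not (isOdd x ∧ isOdd (x / 2)) ∧ fibbinary (x / 2)
    ≡⟨ cong (not (isOdd x ∧ isOdd (x / 2)) ∧_) (fibbinary-leading-11 n (x / 2) lo′ hi′) ⟩
  not (isOdd x ∧ isOdd (x / 2)) ∧ false
    ≡⟨ ∧-zeroʳ _ ⟩
  false ∎
  where
    c = 2 ^ suc n + 2 ^ n
    lo′ : c ≤ x / 2
    lo′ = subst (_≤ x / 2) ([2*q]/2≡q c)
            (/-monoˡ-≤ 2 (subst (_≤ x) (sym (*-distribˡ-+ 2 (2 ^ suc n) (2 ^ n))) lo))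
    hi′ : x / 2 < 2 ^ suc (suc n)
    hi′ = m<n*o⇒m/o<n (subst (x <_) (*-comm 2 (2 ^ suc (suc n))) hi)

Gap : ℕ → ℕ → Set
Gap a b = ∀ y → a < y → y < b → isOddFibbinary y ≡ false

record IsNext (m t : ℕ) : Set where
  field
    above        : m < t
    oddFibbinary : isOddFibbinary t ≡ true
    gap          : Gap m t

gap-empty : ∀ m → Gap m (suc m)
gap-empty m y m<y y<1+m = ⊥-elim (n≮n y (<-≤-trans y<1+m m<y))

gap-extendˡ : ∀ {m t} → isOddFibbinary (suc m) ≡ false → Gap (suc m) t → Gap m t
gap-extendˡ 1+m-not gap y m<y y<t with m≤n⇒m<n∨m≡n m<y
... | inj₁ 1+m<y = gap y 1+m<y y<t
... | inj₂ refl  = 1+m-not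

isNext-minimal : ∀ {m t t′} → IsNext m t → m < t′ → isOddFibbinary t′ ≡ true → t ≤ t′
isNext-minimal {t = t} {t′} next m<t′ t′-odd-fib with t′ <? t
... | no  t′≮t = ≮⇒≥ t′≮t
... | yes t′<t with () ← trans (sym t′-odd-fib) (IsNext.gap next t′ m<t′ t′<t)

isNext-unique : ∀ {m t t′} → IsNext m t → IsNext m t′ → t ≡ t′
isNext-unique next next′ =
  ≤-antisym (isNext-minimal next (IsNext.above next′) (IsNext.oddFibbinary next′))
            (isNext-minimal next′ (IsNext.above next) (IsNext.oddFibbinary next))

nextFrom-isNext : ∀ f m w → m < w → w ≤ m + f → isOddFibbinary w ≡ true → IsNext m (nextFrom f m)
nextFrom-isNext zero    m w m<w w≤m+0 _ =
  ⊥-elim (n≮n m (<-≤-trans m<w (subst (w ≤_) (+-identityʳ m) w≤m+0)))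
nextFrom-isNext (suc f) m w m<w w≤m+1+f w-odd-fib with isOddFibbinary (suc m) in 1+m-odd-fib
... | true  = record { above = n<1+n m ; oddFibbinary = 1+m-odd-fib ; gap = gap-empty m }
... | false with m≤n⇒m<n∨m≡n m<w
...   | inj₂ refl with () ← trans (sym w-odd-fib) 1+m-odd-fib
...   | inj₁ 1+m<w = record
  { above        = <-trans (n<1+n m) (IsNext.above next)
  ; oddFibbinary = IsNext.oddFibbinary next
  ; gap          = gap-extendˡ 1+m-odd-fib (IsNext.gap next)
  }
  where next = nextFrom-isNext f (suc m) w 1+m<w (subst (w ≤_) (+-suc m f) w≤m+1+f) w-odd-fib

nextOdfib-isNext : ∀ m → isOddFibbinary (1 + 2 * (2 * m)) ≡ true → IsNext m (nextOdfib m)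
nextOdfib-isNext m =
  nextFrom-isNext (3 * m + 1) m (1 + 2 * (2 * m))
    (s≤s (≤-trans (m≤n*m m 2) (m≤n*m (2 * m) 2))) (≤-reflexive (search-bound m))
  where
    search-bound : ∀ m → 1 + 2 * (2 * m) ≡ m + (3 * m + 1)
    search-bound = solve-∀

odfib-isNext : ∀ k → IsNext (odfib k) (odfib (suc k))
odfib-isNext zero    = nextOdfib-isNext 0 refl
odfib-isNext (suc k) = nextOdfib-isNext (odfib (suc k))
  (isOddFibbinary-1+4* (odfib (suc k)) (IsNext.oddFibbinary (odfib-isNext k)))

odfib-mono-≤′ : ∀ {i j} → i ≤′ j → odfib i ≤ odfib j
odfib-mono-≤′ ≤′-refl        = ≤-refl
odfib-mono-≤′ (≤′-step {j} i≤′j) = ≤-trans (odfib-mono-≤′ i≤′j) (<⇒≤ (IsNext.above (odfib-isNext j)))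

odfib-mono-≤ : ∀ {i j} → i ≤ j → odfib i ≤ odfib j
odfib-mono-≤ i≤j = odfib-mono-≤′ (≤⇒≤′ i≤j)

gap-2^+ : ∀ n {a b} → b ≤ 2 ^ n → Gap a b → Gap (2 ^ suc n + a) (2 ^ suc n + b)
gap-2^+ n {a} {b} b≤2^n gap y P+a<y y<P+b
  with z , refl ← m≤n⇒∃[o]m+o≡n (≤-trans (m≤m+n (2 ^ suc n) a) (<⇒≤ P+a<y)) = begin
  isOddFibbinary (2 ^ suc n + z) ≡⟨ isOddFibbinary-2^+ n z (<-≤-trans z<b b≤2^n) ⟩
  isOddFibbinary z               ≡⟨ gap z (+-cancelˡ-< (2 ^ suc n) a z P+a<y) z<b ⟩
  false                          ∎
  where
    z<b : z < b
    z<b = +-cancelˡ-< (2 ^ suc n) z b y<P+b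

isNext-2^+ : ∀ n {a b} → b < 2 ^ n → IsNext a b → IsNext (2 ^ suc n + a) (2 ^ suc n + b)
isNext-2^+ n b<2^n next = record
  { above        = +-monoʳ-< (2 ^ suc n) (IsNext.above next)
  ; oddFibbinary = trans (isOddFibbinary-2^+ n _ b<2^n) (IsNext.oddFibbinary next)
  ; gap          = gap-2^+ n (<⇒≤ b<2^n) (IsNext.gap next)
  }

isNext-2^+1 : ∀ n {a} → 1 < 2 ^ n → a < 2 ^ suc n → Gap a (2 ^ suc n) → IsNext a (2 ^ suc n + 1)
isNext-2^+1 n {a} 1<2^n a<P gap = record
  { above        = ≤-trans a<P (m≤m+n (2 ^ suc n) 1)
  ; oddFibbinary = isOddFibbinary-2^+ n 1 1<2^n
  ; gap          = gap′
  }
  where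
    gap′ : Gap a (2 ^ suc n + 1)
    gap′ y a<y y<P+1 with m≤n⇒m<n∨m≡n (≤-pred (subst (y <_) (+-comm (2 ^ suc n) 1) y<P+1))
    ... | inj₁ y<P = gap y a<y y<P
    ... | inj₂ refl = isOddFibbinary-2* (2 ^ n)

-- Equivalently, exactly F n odd fibbinary numbers lie below 2 ^ n.
LastBelow2^ : ℕ → Set
LastBelow2^ n = odfib (F n) < 2 ^ n × Gap (odfib (F n)) (2 ^ n)

odfib-F+ : ∀ n → LastBelow2^ n → LastBelow2^ (suc n) →
  ∀ k → 1 ≤ k → k ≤ F n → odfib (F (suc n) + k) ≡ 2 ^ suc n + odfib k
odfib-F+ n below (top<P , gap-below-P) (suc k) _ = go k
  where
    P = 2 ^ suc n
    odfib<2^n : ∀ {i} → i ≤ F n → odfib i < 2 ^ n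
    odfib<2^n i≤Fn = ≤-<-trans (odfib-mono-≤ i≤Fn) (proj₁ below)
    go : ∀ k → suc k ≤ F n → odfib (F (suc n) + suc k) ≡ P + odfib (suc k)
    go zero 1≤Fn = begin
      odfib (F (suc n) + 1)   ≡⟨ cong odfib (+-comm (F (suc n)) 1) ⟩
      odfib (suc (F (suc n))) ≡⟨ isNext-unique (odfib-isNext (F (suc n)))
                                   (isNext-2^+1 n (odfib<2^n 1≤Fn) top<P gap-below-P) ⟩
      P + 1                   ∎
    go (suc k) 2+k≤Fn = begin
      odfib (F (suc n) + suc (suc k)) ≡⟨ cong odfib (+-suc (F (suc n)) (suc k)) ⟩
      odfib (suc (F (suc n) + suc k)) ≡⟨ isNext-unique next shifted ⟩
      P + odfib (suc (suc k))         ∎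
      where
        next : IsNext (P + odfib (suc k)) (odfib (suc (F (suc n) + suc k)))
        next = subst (λ a → IsNext a (odfib (suc (F (suc n) + suc k)))) (go k (<⇒≤ 2+k≤Fn))
                 (odfib-isNext (F (suc n) + suc k))
        shifted : IsNext (P + odfib (suc k)) (P + odfib (suc (suc k)))
        shifted = isNext-2^+ n (odfib<2^n 2+k≤Fn) (odfib-isNext (suc k))

F-pos : ∀ n → 1 ≤ F (suc n)
F-pos zero    = ≤-refl
F-pos (suc n) = ≤-trans (F-pos n) (m≤m+n (F (suc n)) (F n))

lastBelow2^-step : ∀ n → LastBelow2^ (suc n) → LastBelow2^ (suc (suc n)) →
  LastBelow2^ (suc (suc (suc n)))
lastBelow2^-step n below below′ = subst (λ t → t < 2 * P × Gap t (2 * P)) (sym top) (P+L<2P , gap)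
  where
    P = 2 ^ suc (suc n)
    L = odfib (F (suc n))
    top : odfib (F (suc (suc (suc n)))) ≡ P + L
    top = odfib-F+ (suc n) below below′ (F (suc n)) (F-pos n) ≤-refl
    P+L<2P : P + L < P + (P + 0)
    P+L<2P = +-monoʳ-< P (<-≤-trans (proj₁ below) (≤-trans (m≤m+n (2 ^ suc n) _) (m≤m+n P 0)))
    gap : Gap (P + L) (2 * P)
    gap y P+L<y y<2P with y <? P + 2 ^ suc n
    ... | yes y<P+P/2 = gap-2^+ (suc n) ≤-refl (proj₂ below) y P+L<y y<P+P/2
    ... | no  y≮P+P/2 =
      trans (cong (isOdd y ∧_) (fibbinary-leading-11 (suc n) y (≮⇒≥ y≮P+P/2) y<2P)) (∧-zeroʳ _)

lastBelow2^-1 : LastBelow2^ 1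
lastBelow2^-1 = ≤-refl , gap-empty 1

lastBelow2^-2 : LastBelow2^ 2
lastBelow2^-2 = s≤s (s≤s z≤n) , gap
  where
    gap : Gap 1 4
    gap (suc zero) (s≤s ()) _
    gap (suc (suc zero)) _ _ = refl
    gap (suc (suc (suc zero))) _ _ = refl
    gap (suc (suc (suc (suc _)))) _ (s≤s (s≤s (s≤s (s≤s ()))))

lastBelow2^ : ∀ n → LastBelow2^ (suc n) × LastBelow2^ (suc (suc n))
lastBelow2^ zero    = lastBelow2^-1 , lastBelow2^-2
lastBelow2^ (suc n) with below , below′ ← lastBelow2^ n = below′ , lastBelow2^-step n below below′

lemma1 : (n k : ℕ) → 2 ≤ n → 1 ≤ k → k ≤ F (n ∸ 1) →
    odfib (F n + k) ≡ 2 ^ n + odfib k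
lemma1 (suc zero) _ (s≤s ())
lemma1 (suc (suc n)) k _ =
  odfib-F+ (suc n) (proj₁ (lastBelow2^ n)) (proj₂ (lastBelow2^ n)) k
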